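{- Every Hadamard matrix of order $16$ has a quadruple of distinct rows of type $0$.
   Context: A Hadamard matrix of order $n$ is an $n\times n$ matrix $H=(h_{uv})$ with entries in $\{ -1,1\}$ such that $HH^\top=nI$. For four distinct rows $i,j,k,\ell$ of $H$, put $P_{ijk\ell}=\left|\sum_{r=1}^n h_{ir}h_{jr}h_{kr}h_{\ell r}\right|$; the type of the quadruple $\{i,j,k,\ell\}$ is $T_{ijk\ell}=\frac{n-P_{ijk\ell}}{8}$. -}

module Defs where

open import Data.Nat as ℕ using (ℕ)
open import Data.Fin using (Fin; zero; suc; _≟_)
open import Data.Integer as ℤ using (ℤ; +_; -[1+_]; ∣_∣)
open import Data.Rational as ℚ using (ℚ; _/_)
open import Data.Sum using (_⊎_)
open import Data.Product using (_×_)
open import Relation.Binary.PropositionalEquality using (_≡_; _≢_)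
open import Relation.Nullary using (¬_; yes; no)

Σℤ : (n : ℕ) → (Fin n → ℤ) → ℤ
Σℤ ℕ.zero    f = + 0
Σℤ (ℕ.suc n) f = f zero ℤ.+ Σℤ n (λ i → f (suc i))

Matrix : ℕ → Set
Matrix n = Fin n → Fin n → ℤ

nI : (n : ℕ) → Fin n → Fin n → ℤ
nI n u v with u ≟ v
... | yes _ = + n
... | no  _ = + 0

record IsHadamard (n : ℕ) (H : Matrix n) : Set where
  field
    entries : ∀ u v → (H u v ≡ + 1) ⊎ (H u v ≡ -[1+ 0 ])
    orth    : ∀ u v → Σℤ n (λ r → H u r ℤ.* H v r) ≡ nI n u v

P : (n : ℕ) → Matrix n → (i j k l : Fin n) → ℕ
P n H i j k l = ∣ Σℤ n (λ r → H i r ℤ.* H j r ℤ.* H k r ℤ.* H l r) ∣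

T : (n : ℕ) → Matrix n → (i j k l : Fin n) → ℚ
T n H i j k l = (+ n ℤ.- + P n H i j k l) / 8

Distinct4 : ∀ {n} → (i j k l : Fin n) → Set
Distinct4 i j k l = i ≢ j × i ≢ k × i ≢ l × j ≢ k × j ≢ l × k ≢ l

-- Fix three rows h₀, h₁, h₂ of a Hadamard matrix H of order 16 and put x = h₀h₁h₂ (entrywise).
-- Since Hᵀ H = 16 I as well, the coefficients c_ℓ = ⟨x, h_ℓ⟩ satisfy Σ_ℓ c_ℓ h_ℓ = 16 x and
-- Σ_ℓ c_ℓ² = 16 ⟨x, x⟩ = 256. Clearly c₀ = c₁ = c₂ = 0. For any other ℓ, 16 + c_ℓ and 16 − c_ℓ
-- are 8 times the number of columns on which h₀, h₁, h₂, h_ℓ all agree, resp. on which h₀ is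
-- the odd one out, so c_ℓ ∈ {0, ±8, ±16}. If some c_ℓ = ±16, rows 0, 1, 2, ℓ have type 0.
-- Otherwise exactly four coefficients are ±8, and 16 x_r = Σ of four terms ±8 forces three
-- of these terms to share a sign; hence the product of the four corresponding rows is
-- constant, and those four rows have type 0.
module Submission where

open import Defs
open import Data.Bool using (if_then_else_)
open import Data.Fin using (Fin; zero; suc; _≟_)
open import Data.Fin.Patterns using (0F; 1F; 2F; 3F)
open import Data.Fin.Properties using (suc-injective)
open import Data.Integer using (ℤ; +_; -[1+_]; ∣_∣; _+_; _-_; _*_; -_; 0ℤ; 1ℤ; -1ℤ; _≤_; +≤+)
import Data.Integer as ℤ
open import Data.Integer.Properties
  using ( +-*-semiring; *-commutativeSemigroup; +-injective; +-identityˡ; +-identityʳ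
        ; +-inverseʳ; i≡j⇒i-j≡0; i-j≡0⇒i≡j; *-identityˡ; *-identityʳ; *-zeroʳ; *-assoc; *-comm
        ; *-distribʳ-+; +-mono-≤; ≤-refl; *-cancelˡ-≡; abs-*; -1*i≡-i; i*j≡0⇒i≡0∨j≡0 )
open import Data.Integer.Tactic.RingSolver using (solve-∀)
open import Data.Nat using (ℕ; zero; suc; z≤n)
import Data.Nat as ℕ
import Data.Nat.Properties as ℕ
open import Data.Product using (_×_; _,_; proj₁; proj₂; ∃-syntax; uncurry)
open import Data.Rational using (0ℚ; _/_)
open import Data.Sum using (_⊎_; inj₁; inj₂; [_,_]′; map₁; reduce)
open import Data.Vec.Functional using (_∷_; transpose)
open import Data.Empty using (⊥-elim)
open import Function using (_∘_; id)
open import Function.Definitions using (Injective)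
open import Relation.Binary.PropositionalEquality
  using (_≡_; _≢_; refl; sym; trans; cong; cong₂; subst; module ≡-Reasoning)
open import Relation.Nullary using (does; yes; no)
open import Algebra.Properties.Semiring.Sum +-*-semiring
  using (sum; sum-syntax; sum-cong-≗; sum-replicate-zero; ∑-distrib-+; ∑-comm; *-distribˡ-sum; *-distribʳ-sum)
open import Algebra.Properties.CommutativeSemigroup *-commutativeSemigroup using (interchange; x∙yz≈y∙xz)

open ≡-Reasoning

-- Finite sums

Σℤ≡∑ : ∀ n (f : Fin n → ℤ) → Σℤ n f ≡ ∑[ i < n ] f i
Σℤ≡∑ zero    f = refl
Σℤ≡∑ (suc n) f = cong (_+_ (f zero)) (Σℤ≡∑ n (f ∘ suc))

∑-const : ∀ n a → ∑[ i < n ] a ≡ + n * a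
∑-const zero    a = refl
∑-const (suc n) a = begin
  a + ∑[ i < n ] a  ≡⟨ cong₂ _+_ (sym (*-identityˡ a)) (∑-const n a) ⟩
  1ℤ * a + + n * a  ≡⟨ *-distribʳ-+ a 1ℤ (+ n) ⟨
  + suc n * a       ∎

∑-linear : ∀ {n} (f g h : Fin n → ℤ) k →
  ∑[ i < n ] (f i + k * g i + h i) ≡ ∑[ i < n ] f i + k * ∑[ i < n ] g i + ∑[ i < n ] h i
∑-linear {n} f g h k = begin
  ∑[ i < n ] (f i + k * g i + h i)
    ≡⟨ ∑-distrib-+ _ h ⟩
  ∑[ i < n ] (f i + k * g i) + ∑[ i < n ] h i
    ≡⟨ cong (_+ ∑[ i < n ] h i) (∑-distrib-+ f _) ⟩
  ∑[ i < n ] f i + ∑[ i < n ] (k * g i) + ∑[ i < n ] h i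
    ≡⟨ cong (λ s → ∑[ i < n ] f i + s + ∑[ i < n ] h i) (*-distribˡ-sum k g) ⟨
  ∑[ i < n ] f i + k * ∑[ i < n ] g i + ∑[ i < n ] h i ∎

∑-+-zeroˡ : ∀ {n} {f g : Fin n → ℤ} → ∑[ i < n ] f i ≡ 0ℤ → ∑[ i < n ] (f i + g i) ≡ ∑[ i < n ] g i
∑-+-zeroˡ {f = f} {g} ∑f≡0 = trans (∑-distrib-+ f g) (trans (cong (_+ _) ∑f≡0) (+-identityˡ _))

∑-*-∑ : ∀ {m n} (f : Fin m → ℤ) (g : Fin n → ℤ) →
  ∑[ i < m ] f i * ∑[ j < n ] g j ≡ ∑[ i < m ] ∑[ j < n ] (f i * g j)
∑-*-∑ f g = trans (*-distribʳ-sum (sum g) f) (sum-cong-≗ (λ i → *-distribˡ-sum (f i) g))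

∑∑-cong : ∀ {m n} {f g : Fin m → Fin n → ℤ} → (∀ i j → f i j ≡ g i j) →
  ∑[ i < m ] ∑[ j < n ] f i j ≡ ∑[ i < m ] ∑[ j < n ] g i j
∑∑-cong f≡g = sum-cong-≗ (λ i → sum-cong-≗ (f≡g i))

∑∑-comm : ∀ {m n} (f : Fin m → Fin m → Fin n → Fin n → ℤ) →
  ∑[ r < m ] ∑[ s < m ] ∑[ u < n ] ∑[ v < n ] f r s u v ≡
  ∑[ u < n ] ∑[ v < n ] ∑[ r < m ] ∑[ s < m ] f r s u v
∑∑-comm {m} {n} f = begin
  ∑[ r < m ] ∑[ s < m ] ∑[ u < n ] ∑[ v < n ] f r s u v
    ≡⟨ sum-cong-≗ (λ r → ∑-comm (λ s u → ∑[ v < n ] f r s u v)) ⟩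
  ∑[ r < m ] ∑[ u < n ] ∑[ s < m ] ∑[ v < n ] f r s u v
    ≡⟨ ∑-comm (λ r u → ∑[ s < m ] ∑[ v < n ] f r s u v) ⟩
  ∑[ u < n ] ∑[ r < m ] ∑[ s < m ] ∑[ v < n ] f r s u v
    ≡⟨ ∑∑-cong (λ u r → ∑-comm (λ s v → f r s u v)) ⟩
  ∑[ u < n ] ∑[ r < m ] ∑[ v < n ] ∑[ s < m ] f r s u v
    ≡⟨ sum-cong-≗ (λ u → ∑-comm (λ r v → ∑[ s < m ] f r s u v)) ⟩
  ∑[ u < n ] ∑[ v < n ] ∑[ r < m ] ∑[ s < m ] f r s u v ∎

∑-nonneg : ∀ {n} (f : Fin n → ℤ) → (∀ i → 0ℤ ≤ f i) → 0ℤ ≤ ∑[ i < n ] f i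
∑-nonneg {zero}  f 0≤f = ≤-refl
∑-nonneg {suc n} f 0≤f = +-mono-≤ (0≤f zero) (∑-nonneg (f ∘ suc) (0≤f ∘ suc))

nonneg-+≡0 : ∀ {i j} → 0ℤ ≤ i → 0ℤ ≤ j → i + j ≡ 0ℤ → i ≡ 0ℤ × j ≡ 0ℤ
nonneg-+≡0 {+ m} (+≤+ _) (+≤+ _) i+j≡0 =
  cong +_ (ℕ.m+n≡0⇒m≡0 m (+-injective i+j≡0)) , cong +_ (ℕ.m+n≡0⇒n≡0 m (+-injective i+j≡0))

∑-nonneg≡0 : ∀ {n} (f : Fin n → ℤ) → (∀ i → 0ℤ ≤ f i) → ∑[ i < n ] f i ≡ 0ℤ → ∀ i → f i ≡ 0ℤ
∑-nonneg≡0 f 0≤f ∑f≡0 zero    = proj₁ (nonneg-+≡0 (0≤f zero) (∑-nonneg (f ∘ suc) (0≤f ∘ suc)) ∑f≡0)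
∑-nonneg≡0 f 0≤f ∑f≡0 (suc i) =
  ∑-nonneg≡0 (f ∘ suc) (0≤f ∘ suc) (proj₂ (nonneg-+≡0 (0≤f zero) (∑-nonneg (f ∘ suc) (0≤f ∘ suc)) ∑f≡0)) i

_∈8ℕ : ℤ → Set
x ∈8ℕ = ∃[ k ] x ≡ + (k ℕ.* 8)

∑-∈8ℕ : ∀ {n} (f : Fin n → ℤ) → (∀ i → f i ∈8ℕ) → (∑[ i < n ] f i) ∈8ℕ
∑-∈8ℕ {zero}  f _   = 0 , refl
∑-∈8ℕ {suc n} f f∈8ℕ with f∈8ℕ zero | ∑-∈8ℕ (f ∘ suc) (f∈8ℕ ∘ suc)
... | k , fzero≡8k | k′ , ∑≡8k′ =
  k ℕ.+ k′ , trans (cong₂ _+_ fzero≡8k ∑≡8k′) (cong +_ (sym (ℕ.*-distribʳ-+ 8 k k′)))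

-- Inner products and Gram matrices

⟨_,_⟩ : ∀ {n} → (Fin n → ℤ) → (Fin n → ℤ) → ℤ
⟨_,_⟩ {n} x y = ∑[ r < n ] (x r * y r)

⟨*,⟩ : ∀ {n} k (x y : Fin n → ℤ) → ⟨ (λ r → k * x r) , y ⟩ ≡ k * ⟨ x , y ⟩
⟨*,⟩ k x y = trans (sum-cong-≗ (λ r → *-assoc k (x r) (y r))) (sym (*-distribˡ-sum k (λ r → x r * y r)))

⟨,*⟩ : ∀ {n} k (x y : Fin n → ℤ) → ⟨ x , (λ r → k * y r) ⟩ ≡ k * ⟨ x , y ⟩
⟨,*⟩ k x y = trans (sum-cong-≗ (λ r → x∙yz≈y∙xz (x r) k (y r))) (sym (*-distribˡ-sum k (λ r → x r * y r)))

-- The order ⟨ x , A ℓ ⟩ makes the summands of (H *ᵥ (h₀h₁h₂)) ℓ literally those of P.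
_*ᵥ_ : ∀ {n} → Matrix n → (Fin n → ℤ) → Fin n → ℤ
(A *ᵥ x) ℓ = ⟨ x , A ℓ ⟩

gram : ∀ {n} → Matrix n → Matrix n
gram A u v = ⟨ A u , A v ⟩

trace : ∀ {n} → Matrix n → ℤ
trace {n} M = ∑[ r < n ] M r r

frobenius² : ∀ {n} → Matrix n → ℤ
frobenius² {n} M = ∑[ r < n ] ⟨ M r , M r ⟩

δ : ∀ {n} → Fin n → Fin n → ℤ
δ u v = if does (u ≟ v) then 1ℤ else 0ℤ

nI≡n*δ : ∀ n (u v : Fin n) → nI n u v ≡ + n * δ u v
nI≡n*δ n u v with u ≟ v
... | yes _ = sym (*-identityʳ (+ n))
... | no  _ = sym (*-zeroʳ (+ n))

∑-δ : ∀ {n} (f : Fin n → ℤ) r → ∑[ s < n ] (f s * δ r s) ≡ f r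
∑-δ {suc n} f zero = begin
  f zero * 1ℤ + ∑[ s < n ] (f (suc s) * 0ℤ)
    ≡⟨ cong₂ _+_ (*-identityʳ (f zero)) (sum-cong-≗ (*-zeroʳ ∘ f ∘ suc)) ⟩
  f zero + ∑[ s < n ] 0ℤ
    ≡⟨ cong (_+_ (f zero)) (sum-replicate-zero n) ⟩
  f zero + 0ℤ
    ≡⟨ +-identityʳ (f zero) ⟩
  f zero ∎
∑-δ {suc n} f (suc r) =
  trans (cong (_+ ∑[ s < n ] (f (suc s) * δ r s)) (*-zeroʳ (f zero))) (trans (+-identityˡ _) (∑-δ (f ∘ suc) r))

∑-nI : ∀ n (f : Fin n → ℤ) r → ∑[ s < n ] (f s * nI n r s) ≡ + n * f r
∑-nI n f r = begin
  ∑[ s < n ] (f s * nI n r s)    ≡⟨ sum-cong-≗ (λ s → cong (f s *_) (nI≡n*δ n r s)) ⟩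
  ∑[ s < n ] (f s * (+ n * δ r s)) ≡⟨ ⟨,*⟩ (+ n) f (δ r) ⟩
  + n * ∑[ s < n ] (f s * δ r s) ≡⟨ cong (+ n *_) (∑-δ f r) ⟩
  + n * f r                      ∎

frobenius²-gram-transpose : ∀ {n} (A : Matrix n) → frobenius² (gram (transpose A)) ≡ frobenius² (gram A)
frobenius²-gram-transpose {n} A = begin
  ∑[ r < n ] ∑[ s < n ] (gram (transpose A) r s * gram (transpose A) r s)
    ≡⟨ ∑∑-cong (λ r s → ∑-*-∑ (λ u → A u r * A u s) (λ v → A v r * A v s)) ⟩
  ∑[ r < n ] ∑[ s < n ] ∑[ u < n ] ∑[ v < n ] (A u r * A u s * (A v r * A v s))
    ≡⟨ ∑∑-comm (λ r s u v → A u r * A u s * (A v r * A v s)) ⟩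
  ∑[ u < n ] ∑[ v < n ] ∑[ r < n ] ∑[ s < n ] (A u r * A u s * (A v r * A v s))
    ≡⟨ ∑∑-cong (λ u v → ∑∑-cong (λ r s → interchange (A u r) (A u s) (A v r) (A v s))) ⟩
  ∑[ u < n ] ∑[ v < n ] ∑[ r < n ] ∑[ s < n ] (A u r * A v r * (A u s * A v s))
    ≡⟨ ∑∑-cong (λ u v → ∑-*-∑ (λ r → A u r * A v r) (λ s → A u s * A v s)) ⟨
  ∑[ u < n ] ∑[ v < n ] (gram A u v * gram A u v) ∎

trace-gram-transpose : ∀ {n} (A : Matrix n) → trace (gram (transpose A)) ≡ trace (gram A)
trace-gram-transpose A = ∑-comm (λ r u → A u r * A u r)

frobenius²-sub-nI : ∀ n (M : Matrix n) →
  frobenius² (λ r s → M r s - nI n r s) ≡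
  frobenius² M + -[1+ 1 ] * (+ n * trace M) + frobenius² (nI n)
frobenius²-sub-nI n M = begin
  ∑[ r < n ] ⟨ D r , D r ⟩
    ≡⟨ sum-cong-≗ row ⟩
  ∑[ r < n ] (⟨ M r , M r ⟩ + -[1+ 1 ] * (+ n * M r r) + ⟨ N r , N r ⟩)
    ≡⟨ ∑-linear (λ r → ⟨ M r , M r ⟩) (λ r → + n * M r r) (λ r → ⟨ N r , N r ⟩) -[1+ 1 ] ⟩
  frobenius² M + -[1+ 1 ] * ∑[ r < n ] (+ n * M r r) + frobenius² N
    ≡⟨ cong (λ t → frobenius² M + -[1+ 1 ] * t + frobenius² N) (*-distribˡ-sum (+ n) (λ r → M r r)) ⟨
  frobenius² M + -[1+ 1 ] * (+ n * trace M) + frobenius² N ∎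
  where
  N = nI n
  D : Matrix n
  D r s = M r s - N r s
  row : ∀ r → ⟨ D r , D r ⟩ ≡ ⟨ M r , M r ⟩ + -[1+ 1 ] * (+ n * M r r) + ⟨ N r , N r ⟩
  square-of-difference : ∀ a b → (a - b) * (a - b) ≡ a * a + -[1+ 1 ] * (a * b) + b * b
  square-of-difference = solve-∀
  row r = begin
    ⟨ D r , D r ⟩
      ≡⟨ sum-cong-≗ (λ s → square-of-difference (M r s) (N r s)) ⟩
    ∑[ s < n ] (M r s * M r s + -[1+ 1 ] * (M r s * N r s) + N r s * N r s)
      ≡⟨ ∑-linear (λ s → M r s * M r s) (λ s → M r s * N r s) (λ s → N r s * N r s) -[1+ 1 ] ⟩
    ⟨ M r , M r ⟩ + -[1+ 1 ] * ∑[ s < n ] (M r s * N r s) + ⟨ N r , N r ⟩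
      ≡⟨ cong (λ t → ⟨ M r , M r ⟩ + -[1+ 1 ] * t + ⟨ N r , N r ⟩) (∑-nI n (M r) r) ⟩
    ⟨ M r , M r ⟩ + -[1+ 1 ] * (+ n * M r r) + ⟨ N r , N r ⟩ ∎

0≤i*i : ∀ i → 0ℤ ≤ i * i
0≤i*i (+ zero)  = ≤-refl
0≤i*i (+ suc n) = +≤+ z≤n
0≤i*i -[1+ n ]  = +≤+ z≤n

frobenius²≡0 : ∀ {n} (M : Matrix n) → frobenius² M ≡ 0ℤ → ∀ r s → M r s ≡ 0ℤ
frobenius²≡0 M ‖M‖²≡0 r s = reduce (i*j≡0⇒i≡0∨j≡0 (M r s) (∑-nonneg≡0 _ (0≤i*i ∘ M r) ⟨Mr,Mr⟩≡0 s))
  where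
  ⟨Mr,Mr⟩≡0 : ⟨ M r , M r ⟩ ≡ 0ℤ
  ⟨Mr,Mr⟩≡0 = ∑-nonneg≡0 _ (λ r′ → ∑-nonneg _ (0≤i*i ∘ M r′)) ‖M‖²≡0 r

-- frobenius² (AᵀA − nI) = frobenius² (AAᵀ − nI), since both only depend on
-- frobenius² and trace of the Gram matrix, which agree for A and Aᵀ.
gram-transpose-orthogonal : ∀ n (A : Matrix n) → (∀ u v → gram A u v ≡ nI n u v) →
  ∀ r s → gram (transpose A) r s ≡ nI n r s
gram-transpose-orthogonal n A orth r s = i-j≡0⇒i≡j _ _ (frobenius²≡0 defect defect≡0 r s)
  where
  defect : Matrix n
  defect r s = gram (transpose A) r s - nI n r s
  defect≡0 : frobenius² defect ≡ 0ℤ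
  defect≡0 = begin
    frobenius² defect
      ≡⟨ frobenius²-sub-nI n (gram (transpose A)) ⟩
    frobenius² (gram (transpose A)) + -[1+ 1 ] * (+ n * trace (gram (transpose A))) + frobenius² (nI n)
      ≡⟨ cong₂ (λ f t → f + -[1+ 1 ] * (+ n * t) + frobenius² (nI n))
               (frobenius²-gram-transpose A) (trace-gram-transpose A) ⟩
    frobenius² (gram A) + -[1+ 1 ] * (+ n * trace (gram A)) + frobenius² (nI n)
      ≡⟨ frobenius²-sub-nI n (gram A) ⟨
    frobenius² (λ u v → gram A u v - nI n u v)
      ≡⟨ ∑∑-cong (λ u v → cong (λ d → d * d) (i≡j⇒i-j≡0 (orth u v))) ⟩
    ∑[ u < n ] ∑[ v < n ] 0ℤ
      ≡⟨ sum-cong-≗ {n} (λ _ → sum-replicate-zero n) ⟩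
    ∑[ u < n ] 0ℤ
      ≡⟨ sum-replicate-zero n ⟩
    0ℤ ∎

transpose-*ᵥ-*ᵥ : ∀ {n} (A : Matrix n) → (∀ r s → gram (transpose A) r s ≡ nI n r s) →
  ∀ x r → (transpose A *ᵥ (A *ᵥ x)) r ≡ + n * x r
transpose-*ᵥ-*ᵥ {n} A columns x r = begin
  ∑[ ℓ < n ] (⟨ x , A ℓ ⟩ * A ℓ r)
    ≡⟨ sum-cong-≗ (λ ℓ → *-distribʳ-sum (A ℓ r) (λ s → x s * A ℓ s)) ⟩
  ∑[ ℓ < n ] ∑[ s < n ] (x s * A ℓ s * A ℓ r)
    ≡⟨ ∑-comm (λ ℓ s → x s * A ℓ s * A ℓ r) ⟩
  ∑[ s < n ] ∑[ ℓ < n ] (x s * A ℓ s * A ℓ r)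
    ≡⟨ ∑∑-cong (λ s ℓ → regroup (x s) (A ℓ s) (A ℓ r)) ⟩
  ∑[ s < n ] ∑[ ℓ < n ] (x s * (A ℓ r * A ℓ s))
    ≡⟨ sum-cong-≗ (λ s → *-distribˡ-sum (x s) (λ ℓ → A ℓ r * A ℓ s)) ⟨
  ∑[ s < n ] (x s * gram (transpose A) r s)
    ≡⟨ sum-cong-≗ (λ s → cong (x s *_) (columns r s)) ⟩
  ∑[ s < n ] (x s * nI n r s)
    ≡⟨ ∑-nI n x r ⟩
  + n * x r ∎
  where
  regroup : ∀ a b c → a * b * c ≡ a * (c * b)
  regroup = solve-∀

parseval : ∀ {n} (A : Matrix n) → (∀ r s → gram (transpose A) r s ≡ nI n r s) →
  ∀ x → ⟨ A *ᵥ x , A *ᵥ x ⟩ ≡ + n * ⟨ x , x ⟩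
parseval {n} A columns x = begin
  ∑[ ℓ < n ] (c ℓ * ⟨ x , A ℓ ⟩)
    ≡⟨ sum-cong-≗ (λ ℓ → *-distribˡ-sum (c ℓ) (λ r → x r * A ℓ r)) ⟩
  ∑[ ℓ < n ] ∑[ r < n ] (c ℓ * (x r * A ℓ r))
    ≡⟨ ∑-comm (λ ℓ r → c ℓ * (x r * A ℓ r)) ⟩
  ∑[ r < n ] ∑[ ℓ < n ] (c ℓ * (x r * A ℓ r))
    ≡⟨ ∑∑-cong (λ r ℓ → x∙yz≈y∙xz (c ℓ) (x r) (A ℓ r)) ⟩
  ∑[ r < n ] ∑[ ℓ < n ] (x r * (c ℓ * A ℓ r))
    ≡⟨ sum-cong-≗ (λ r → *-distribˡ-sum (x r) (λ ℓ → c ℓ * A ℓ r)) ⟨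
  ∑[ r < n ] (x r * (transpose A *ᵥ c) r)
    ≡⟨ sum-cong-≗ (λ r → cong (x r *_) (transpose-*ᵥ-*ᵥ A columns x r)) ⟩
  ⟨ x , (λ r → + n * x r) ⟩
    ≡⟨ ⟨,*⟩ (+ n) x x ⟩
  + n * ⟨ x , x ⟩ ∎
  where
  c = A *ᵥ x

-- Signs

Sign : ℤ → Set
Sign x = x ≡ 1ℤ ⊎ x ≡ -1ℤ

sign² : ∀ {x} → Sign x → x * x ≡ 1ℤ
sign² (inj₁ refl) = refl
sign² (inj₂ refl) = refl

sign-* : ∀ {x y} → Sign x → Sign y → Sign (x * y)
sign-* (inj₁ refl) (inj₁ refl) = inj₁ refl
sign-* (inj₁ refl) (inj₂ refl) = inj₂ refl
sign-* (inj₂ refl) (inj₁ refl) = inj₂ refl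
sign-* (inj₂ refl) (inj₂ refl) = inj₁ refl

sign-neg : ∀ {x} → Sign x → Sign (- x)
sign-neg (inj₁ refl) = inj₂ refl
sign-neg (inj₂ refl) = inj₁ refl

∣sign∣ : ∀ {x} → Sign x → ∣ x ∣ ≡ 1
∣sign∣ (inj₁ refl) = refl
∣sign∣ (inj₂ refl) = refl

∣2*sign∣ : ∀ {x} → Sign x → ∣ + 2 * x ∣ ≡ 2
∣2*sign∣ (inj₁ refl) = refl
∣2*sign∣ (inj₂ refl) = refl

⟨sign,sign⟩ : ∀ {n} {x : Fin n → ℤ} → (∀ r → Sign (x r)) → ⟨ x , x ⟩ ≡ + n
⟨sign,sign⟩ {n} ±x = trans (sum-cong-≗ (sign² ∘ ±x)) (trans (∑-const n 1ℤ) (*-identityʳ (+ n)))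

∑-sign²-factor : ∀ {n} {a f g : Fin n → ℤ} → (∀ r → Sign (a r)) → (∀ r → f r ≡ a r * a r * g r) →
  ∑[ r < n ] f r ≡ ∑[ r < n ] g r
∑-sign²-factor ±a f≡aag =
  sum-cong-≗ (λ r → trans (f≡aag r) (trans (cong (_* _) (sign² (±a r))) (*-identityˡ _)))

∣∑-const-sign∣ : ∀ {n} {f : Fin n → ℤ} {σ} → Sign σ → (∀ r → f r ≡ σ) → ∣ ∑[ r < n ] f r ∣ ≡ n
∣∑-const-sign∣ {n} {f} {σ} ±σ f≡σ = begin
  ∣ ∑[ r < n ] f r ∣ ≡⟨ cong ∣_∣ (trans (sum-cong-≗ f≡σ) (∑-const n σ)) ⟩
  ∣ + n * σ ∣        ≡⟨ abs-* (+ n) σ ⟩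
  n ℕ.* ∣ σ ∣        ≡⟨ cong (n ℕ.*_) (∣sign∣ ±σ) ⟩
  n ℕ.* 1            ≡⟨ ℕ.*-identityʳ n ⟩
  n                  ∎

-- Agreements among four pairwise orthogonal sign vectors

agreement-∈8ℕ : ∀ {s t u} → Sign s → Sign t → Sign u → ((1ℤ + s) * (1ℤ + t) * (1ℤ + u)) ∈8ℕ
agreement-∈8ℕ (inj₁ refl) (inj₁ refl) (inj₁ refl) = 1 , refl
agreement-∈8ℕ (inj₁ refl) (inj₁ refl) (inj₂ refl) = 0 , refl
agreement-∈8ℕ (inj₁ refl) (inj₂ refl) _           = 0 , refl
agreement-∈8ℕ (inj₂ refl) _           _           = 0 , refl

agreement-expansion : ∀ a b d e →
  (1ℤ + a * b) * (1ℤ + a * d) * (1ℤ + a * e) ≡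
  1ℤ + (a * b + a * d + a * e) + a * a * (b * d + b * e + d * e + a * b * d * e)
agreement-expansion = solve-∀

agreement-count : ∀ {n} {a b d e : Fin n → ℤ} → (∀ r → Sign (a r)) →
  ⟨ a , b ⟩ ≡ 0ℤ → ⟨ a , d ⟩ ≡ 0ℤ → ⟨ a , e ⟩ ≡ 0ℤ → ⟨ b , d ⟩ ≡ 0ℤ → ⟨ b , e ⟩ ≡ 0ℤ → ⟨ d , e ⟩ ≡ 0ℤ →
  ∑[ r < n ] ((1ℤ + a r * b r) * (1ℤ + a r * d r) * (1ℤ + a r * e r)) ≡
  + n + ∑[ r < n ] (a r * b r * d r * e r)
agreement-count {n} {a} {b} {d} {e} ±a a⊥b a⊥d a⊥e b⊥d b⊥e d⊥e = begin
  ∑[ r < n ] ((1ℤ + a r * b r) * (1ℤ + a r * d r) * (1ℤ + a r * e r))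
    ≡⟨ sum-cong-≗ expansion ⟩
  ∑[ r < n ] (1ℤ + X r + Y r)
    ≡⟨ ∑-distrib-+ (λ r → 1ℤ + X r) Y ⟩
  ∑[ r < n ] (1ℤ + X r) + ∑[ r < n ] Y r
    ≡⟨ cong₂ _+_ (∑-distrib-+ (λ _ → 1ℤ) X) Y-sum ⟩
  ∑[ r < n ] 1ℤ + ∑[ r < n ] X r + ∑[ r < n ] q r
    ≡⟨ cong (_+ ∑[ r < n ] q r) (cong₂ _+_ (∑-const n 1ℤ) X-sum) ⟩
  + n * 1ℤ + 0ℤ + ∑[ r < n ] q r
    ≡⟨ cong (_+ ∑[ r < n ] q r) (trans (+-identityʳ (+ n * 1ℤ)) (*-identityʳ (+ n))) ⟩
  + n + ∑[ r < n ] q r ∎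
  where
  q X Y : Fin n → ℤ
  q r = a r * b r * d r * e r
  X r = a r * b r + a r * d r + a r * e r
  Y r = b r * d r + b r * e r + d r * e r + q r
  expansion : ∀ r → (1ℤ + a r * b r) * (1ℤ + a r * d r) * (1ℤ + a r * e r) ≡ 1ℤ + X r + Y r
  expansion r = trans (agreement-expansion (a r) (b r) (d r) (e r))
    (cong (_+_ (1ℤ + X r)) (trans (cong (_* Y r) (sign² (±a r))) (*-identityˡ (Y r))))
  X-sum : ∑[ r < n ] X r ≡ 0ℤ
  X-sum = trans (∑-+-zeroˡ {n} (trans (∑-+-zeroˡ {n} a⊥b) a⊥d)) a⊥e
  Y-sum : ∑[ r < n ] Y r ≡ ∑[ r < n ] q r
  Y-sum = ∑-+-zeroˡ {n} (trans (∑-+-zeroˡ {n} (trans (∑-+-zeroˡ {n} b⊥d) b⊥e)) d⊥e)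

-- The second congruence is the first one for −a, which counts the columns where a is the odd one out.
quadruple-sum-congruences : ∀ {n} {a b d e : Fin n → ℤ} →
  (∀ r → Sign (a r)) → (∀ r → Sign (b r)) → (∀ r → Sign (d r)) → (∀ r → Sign (e r)) →
  ⟨ a , b ⟩ ≡ 0ℤ → ⟨ a , d ⟩ ≡ 0ℤ → ⟨ a , e ⟩ ≡ 0ℤ → ⟨ b , d ⟩ ≡ 0ℤ → ⟨ b , e ⟩ ≡ 0ℤ → ⟨ d , e ⟩ ≡ 0ℤ →
  (+ n + ∑[ r < n ] (a r * b r * d r * e r)) ∈8ℕ × (+ n - ∑[ r < n ] (a r * b r * d r * e r)) ∈8ℕ
quadruple-sum-congruences {n} {a} {b} {d} {e} ±a ±b ±d ±e a⊥b a⊥d a⊥e b⊥d b⊥e d⊥e =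
  agreements ±a a⊥b a⊥d a⊥e ,
  subst _∈8ℕ (cong (_+_ (+ n)) negate-a)
    (agreements (λ r → sign-* (inj₂ refl) (±a r)) (negate-a⊥ a⊥b) (negate-a⊥ a⊥d) (negate-a⊥ a⊥e))
  where
  agreements : ∀ {a′} → (∀ r → Sign (a′ r)) → ⟨ a′ , b ⟩ ≡ 0ℤ → ⟨ a′ , d ⟩ ≡ 0ℤ → ⟨ a′ , e ⟩ ≡ 0ℤ →
    (+ n + ∑[ r < n ] (a′ r * b r * d r * e r)) ∈8ℕ
  agreements {a′} ±a′ a′⊥b a′⊥d a′⊥e = subst _∈8ℕ (agreement-count ±a′ a′⊥b a′⊥d a′⊥e b⊥d b⊥e d⊥e)
    (∑-∈8ℕ (λ r → (1ℤ + a′ r * b r) * (1ℤ + a′ r * d r) * (1ℤ + a′ r * e r))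
      (λ r → agreement-∈8ℕ (sign-* (±a′ r) (±b r)) (sign-* (±a′ r) (±d r)) (sign-* (±a′ r) (±e r))))
  negate-a⊥ : ∀ {y} → ⟨ a , y ⟩ ≡ 0ℤ → ⟨ (λ r → -1ℤ * a r) , y ⟩ ≡ 0ℤ
  negate-a⊥ {y} a⊥y = trans (⟨*,⟩ -1ℤ a y) (cong (-1ℤ *_) a⊥y)
  regroup : ∀ a b d e → -1ℤ * a * b * d * e ≡ -1ℤ * (a * b * d * e)
  regroup = solve-∀
  negate-a : ∑[ r < n ] (-1ℤ * a r * b r * d r * e r) ≡ - ∑[ r < n ] (a r * b r * d r * e r)
  negate-a = begin
    ∑[ r < n ] (-1ℤ * a r * b r * d r * e r)   ≡⟨ sum-cong-≗ (λ r → regroup (a r) (b r) (d r) (e r)) ⟩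
    ∑[ r < n ] (-1ℤ * (a r * b r * d r * e r)) ≡⟨ *-distribˡ-sum -1ℤ (λ r → a r * b r * d r * e r) ⟨
    -1ℤ * ∑[ r < n ] (a r * b r * d r * e r)   ≡⟨ -1*i≡-i _ ⟩
    - ∑[ r < n ] (a r * b r * d r * e r)       ∎

EightTimesTrit : ℤ → Set
EightTimesTrit q = ∃[ t ] (t ≡ 0ℤ ⊎ Sign t) × q ≡ + 8 * t

quadruple-sum-values₁₆ : ∀ q → (+ 16 + q) ∈8ℕ → (+ 16 - q) ∈8ℕ → ∣ q ∣ ≡ 16 ⊎ EightTimesTrit q
quadruple-sum-values₁₆ q (k , 16+q≡8k) (k′ , 16-q≡8k′) =
  classify q k (trans (isolate q) (cong (_- + 16) 16+q≡8k)) (trans (cong₂ _+_ (sym 16+q≡8k) (sym 16-q≡8k′)) (total q))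
  where
  isolate : ∀ q → q ≡ + 16 + q - + 16
  isolate = solve-∀
  total : ∀ q → + 16 + q + (+ 16 - q) ≡ + 32
  total = solve-∀
  classify : ∀ q k → q ≡ + (k ℕ.* 8) - + 16 → + (k ℕ.* 8) + + (k′ ℕ.* 8) ≡ + 32 → ∣ q ∣ ≡ 16 ⊎ EightTimesTrit q
  classify _ 0 refl _ = inj₁ refl
  classify _ 1 refl _ = inj₂ (-1ℤ , inj₂ (inj₂ refl) , refl)
  classify _ 2 refl _ = inj₂ (0ℤ , inj₁ refl , refl)
  classify _ 3 refl _ = inj₂ (1ℤ , inj₂ (inj₁ refl) , refl)
  classify _ 4 refl _ = inj₁ refl
  classify _ (suc (suc (suc (suc (suc k))))) _ ()

∣sum∣≡2⇒product≡-1 : ∀ {t₁ t₂ t₃ t₄} → Sign t₁ → Sign t₂ → Sign t₃ → Sign t₄ →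
  ∣ t₁ + (t₂ + (t₃ + (t₄ + 0ℤ))) ∣ ≡ 2 → t₁ * t₂ * t₃ * t₄ ≡ -1ℤ
∣sum∣≡2⇒product≡-1 (inj₁ refl) (inj₁ refl) (inj₁ refl) (inj₁ refl) ()
∣sum∣≡2⇒product≡-1 (inj₁ refl) (inj₁ refl) (inj₁ refl) (inj₂ refl) _  = refl
∣sum∣≡2⇒product≡-1 (inj₁ refl) (inj₁ refl) (inj₂ refl) (inj₁ refl) _  = refl
∣sum∣≡2⇒product≡-1 (inj₁ refl) (inj₁ refl) (inj₂ refl) (inj₂ refl) ()
∣sum∣≡2⇒product≡-1 (inj₁ refl) (inj₂ refl) (inj₁ refl) (inj₁ refl) _  = refl
∣sum∣≡2⇒product≡-1 (inj₁ refl) (inj₂ refl) (inj₁ refl) (inj₂ refl) ()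
∣sum∣≡2⇒product≡-1 (inj₁ refl) (inj₂ refl) (inj₂ refl) (inj₁ refl) ()
∣sum∣≡2⇒product≡-1 (inj₁ refl) (inj₂ refl) (inj₂ refl) (inj₂ refl) _  = refl
∣sum∣≡2⇒product≡-1 (inj₂ refl) (inj₁ refl) (inj₁ refl) (inj₁ refl) _  = refl
∣sum∣≡2⇒product≡-1 (inj₂ refl) (inj₁ refl) (inj₁ refl) (inj₂ refl) ()
∣sum∣≡2⇒product≡-1 (inj₂ refl) (inj₁ refl) (inj₂ refl) (inj₁ refl) ()
∣sum∣≡2⇒product≡-1 (inj₂ refl) (inj₁ refl) (inj₂ refl) (inj₂ refl) _  = refl
∣sum∣≡2⇒product≡-1 (inj₂ refl) (inj₂ refl) (inj₁ refl) (inj₁ refl) ()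
∣sum∣≡2⇒product≡-1 (inj₂ refl) (inj₂ refl) (inj₁ refl) (inj₂ refl) _  = refl
∣sum∣≡2⇒product≡-1 (inj₂ refl) (inj₂ refl) (inj₂ refl) (inj₁ refl) _  = refl
∣sum∣≡2⇒product≡-1 (inj₂ refl) (inj₂ refl) (inj₂ refl) (inj₂ refl) ()

cancel-sign-product : ∀ {s₁ s₂ s₃ s₄ h₁ h₂ h₃ h₄} → Sign (s₁ * s₂ * s₃ * s₄) →
  s₁ * h₁ * (s₂ * h₂) * (s₃ * h₃) * (s₄ * h₄) ≡ -1ℤ → h₁ * h₂ * h₃ * h₄ ≡ - (s₁ * s₂ * s₃ * s₄)
cancel-sign-product {s₁} {s₂} {s₃} {s₄} {h₁} {h₂} {h₃} {h₄} ±S product≡-1 = begin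
  h            ≡⟨ *-identityˡ h ⟨
  1ℤ * h       ≡⟨ cong (_* h) (sign² ±S) ⟨
  S * S * h    ≡⟨ *-assoc S S h ⟩
  S * (S * h)  ≡⟨ cong (S *_) (trans (regroup s₁ s₂ s₃ s₄ h₁ h₂ h₃ h₄) product≡-1) ⟩
  S * -1ℤ      ≡⟨ *-comm S -1ℤ ⟩
  -1ℤ * S      ≡⟨ -1*i≡-i S ⟩
  - S          ∎
  where
  S = s₁ * s₂ * s₃ * s₄
  h = h₁ * h₂ * h₃ * h₄
  regroup : ∀ s₁ s₂ s₃ s₄ h₁ h₂ h₃ h₄ →
    s₁ * s₂ * s₃ * s₄ * (h₁ * h₂ * h₃ * h₄) ≡ s₁ * h₁ * (s₂ * h₂) * (s₃ * h₃) * (s₄ * h₄)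
  regroup = solve-∀

-- Supports of integer vectors

record Support {n} (y : Fin n → ℤ) : Set where
  field
    size      : ℕ
    index     : Fin size → Fin n
    injective : Injective _≡_ _≡_ index
    nonzero   : ∀ j → y (index j) ≢ 0ℤ
    restrict  : ∀ g → ⟨ y , g ⟩ ≡ ⟨ y ∘ index , g ∘ index ⟩

support : ∀ {n} (y : Fin n → ℤ) → Support y
support {zero} y = record
  { size = 0 ; index = λ () ; injective = λ {} ; nonzero = λ () ; restrict = λ _ → refl }
support {suc n} y with support (y ∘ suc) | y zero ℤ.≟ 0ℤ
... | S | yes y₀≡0 = record
  { size      = size
  ; index     = suc ∘ index
  ; injective = injective ∘ suc-injective
  ; nonzero   = nonzero
  ; restrict  = λ g → trans (cong (λ t → t * g zero + ⟨ y ∘ suc , g ∘ suc ⟩) y₀≡0)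
                            (trans (+-identityˡ _) (restrict (g ∘ suc)))
  }
  where open Support S
... | S | no y₀≢0 = record
  { size      = suc size
  ; index     = zero ∷ suc ∘ index
  ; injective = λ { {zero} {zero} _ → refl ; {suc i} {suc j} e → cong suc (injective (suc-injective e)) }
  ; nonzero   = λ { zero → y₀≢0 ; (suc j) → nonzero j }
  ; restrict  = λ g → cong (_+_ (y zero * g zero)) (restrict (g ∘ suc))
  }
  where open Support S

-- Types of quadruples of rows

type-zero : ∀ n (H : Matrix n) i j k l → P n H i j k l ≡ n → T n H i j k l ≡ 0ℚ
type-zero n H i j k l P≡n = trans (cong (λ p → (+ n - + p) / 8) P≡n) (cong (_/ 8) (+-inverseʳ (+ n)))

P≡∣∑∣ : ∀ n (H : Matrix n) i j k l → P n H i j k l ≡ ∣ ∑[ r < n ] (H i r * H j r * H k r * H l r) ∣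
P≡∣∑∣ n H i j k l = cong ∣_∣ (Σℤ≡∑ n (λ r → H i r * H j r * H k r * H l r))

∃⊎∀ : ∀ {n} {A B : Fin n → Set} → (∀ i → A i ⊎ B i) → (∃[ i ] A i) ⊎ (∀ i → B i)
∃⊎∀ {zero}  _      = inj₂ λ ()
∃⊎∀ {suc n} choose with choose zero | ∃⊎∀ (choose ∘ suc)
... | inj₁ a₀ | _            = inj₁ (zero , a₀)
... | inj₂ _  | inj₁ (i , a) = inj₁ (suc i , a)
... | inj₂ b₀ | inj₂ b       = inj₂ λ { zero → b₀ ; (suc i) → b i }

module Order16 (H : Matrix 16) (isH : IsHadamard 16 H) where
  open IsHadamard isH

  TypeZeroQuadruple : Set
  TypeZeroQuadruple = ∃[ i ] ∃[ j ] ∃[ k ] ∃[ l ] (Distinct4 i j k l × T 16 H i j k l ≡ 0ℚ)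

  rows-orthogonal : ∀ u v → gram H u v ≡ nI 16 u v
  rows-orthogonal u v = trans (sym (Σℤ≡∑ 16 (λ r → H u r * H v r))) (orth u v)

  columns-orthogonal : ∀ r s → gram (transpose H) r s ≡ nI 16 r s
  columns-orthogonal = gram-transpose-orthogonal 16 H rows-orthogonal

  x : Fin 16 → ℤ
  x r = H 0F r * H 1F r * H 2F r

  ±x : ∀ r → Sign (x r)
  ±x r = sign-* (sign-* (entries 0F r) (entries 1F r)) (entries 2F r)

  c : Fin 16 → ℤ
  c = H *ᵥ x

  -- For distinct literal rows nI 16 u v computes to 0ℤ, so rows-orthogonal u v is an
  -- orthogonality proof as it stands.
  coefficient-values : ∀ ℓ → (Distinct4 0F 1F 2F ℓ × ∣ c ℓ ∣ ≡ 16) ⊎ EightTimesTrit (c ℓ)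
  coefficient-values 0F = inj₂ (0ℤ , inj₁ refl ,
    trans (∑-sign²-factor (entries 0F) (λ r → first-last (H 0F r) (H 1F r) (H 2F r))) (rows-orthogonal 1F 2F))
    where
    first-last : ∀ a b d → a * b * d * a ≡ a * a * (b * d)
    first-last = solve-∀
  coefficient-values 1F = inj₂ (0ℤ , inj₁ refl ,
    trans (∑-sign²-factor (entries 1F) (λ r → middle (H 0F r) (H 1F r) (H 2F r))) (rows-orthogonal 0F 2F))
    where
    middle : ∀ a b d → a * b * d * b ≡ b * b * (a * d)
    middle = solve-∀
  coefficient-values 2F = inj₂ (0ℤ , inj₁ refl ,
    trans (∑-sign²-factor (entries 2F) (λ r → last (H 0F r) (H 1F r) (H 2F r))) (rows-orthogonal 0F 1F))
    where
    last : ∀ a b d → a * b * d * d ≡ d * d * (a * b)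
    last = solve-∀
  coefficient-values ℓ@(suc (suc (suc _))) =
    map₁ (((λ ()) , (λ ()) , (λ ()) , (λ ()) , (λ ()) , (λ ())) ,_)
      (uncurry (quadruple-sum-values₁₆ (c ℓ))
        (quadruple-sum-congruences (entries 0F) (entries 1F) (entries 2F) (entries ℓ)
          (rows-orthogonal 0F 1F) (rows-orthogonal 0F 2F) (rows-orthogonal 0F ℓ)
          (rows-orthogonal 1F 2F) (rows-orthogonal 1F ℓ) (rows-orthogonal 2F ℓ)))

  chosen-rows-quadruple : ∃[ ℓ ] (Distinct4 0F 1F 2F ℓ × ∣ c ℓ ∣ ≡ 16) → TypeZeroQuadruple
  chosen-rows-quadruple (ℓ , distinct , ∣cℓ∣≡16) =
    0F , 1F , 2F , ℓ , distinct , type-zero 16 H 0F 1F 2F ℓ (trans (P≡∣∑∣ 16 H 0F 1F 2F ℓ) ∣cℓ∣≡16)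

  four-rows-quadruple : ∀ {k} → k ≡ 4 → (y : Fin 16 → ℤ) (index : Fin k → Fin 16) →
    Injective _≡_ _≡_ index → (∀ j → Sign (y (index j))) →
    (∀ r → ⟨ y ∘ index , (λ j → H (index j) r) ⟩ ≡ + 2 * x r) → TypeZeroQuadruple
  four-rows-quadruple refl y index injective ±y expansion =
    a , b , d , e ,
    ((λ ()) ∘ injective , (λ ()) ∘ injective , (λ ()) ∘ injective ,
     (λ ()) ∘ injective , (λ ()) ∘ injective , (λ ()) ∘ injective) ,
    type-zero 16 H a b d e (trans (P≡∣∑∣ 16 H a b d e) (∣∑-const-sign∣ (sign-neg ±S) rows-product))
    where
    a = index 0F
    b = index 1F
    d = index 2F
    e = index 3F
    ±S : Sign (y a * y b * y d * y e)
    ±S = sign-* (sign-* (sign-* (±y 0F) (±y 1F)) (±y 2F)) (±y 3F)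
    ±t : ∀ j r → Sign (y (index j) * H (index j) r)
    ±t j r = sign-* (±y j) (entries (index j) r)
    rows-product : ∀ r → H a r * H b r * H d r * H e r ≡ - (y a * y b * y d * y e)
    rows-product r = cancel-sign-product {y a} {y b} {y d} {y e} {H a r} {H b r} {H d r} {H e r} ±S
      (∣sum∣≡2⇒product≡-1 (±t 0F r) (±t 1F r) (±t 2F r) (±t 3F r)
        (trans (cong ∣_∣ (expansion r)) (∣2*sign∣ (±x r))))

  support-quadruple : (∀ ℓ → EightTimesTrit (c ℓ)) → TypeZeroQuadruple
  support-quadruple small =
    four-rows-quadruple size≡4 y index injective ±y (λ r → trans (sym (restrict (λ ℓ → H ℓ r))) (y-expansion r))
    where
    y : Fin 16 → ℤ
    y ℓ = proj₁ (small ℓ)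
    c≡8y : ∀ ℓ → c ℓ ≡ + 8 * y ℓ
    c≡8y ℓ = proj₂ (proj₂ (small ℓ))
    open Support (support y)
    ±y : ∀ j → Sign (y (index j))
    ±y j = [ ⊥-elim ∘ nonzero j , id ]′ (proj₁ (proj₂ (small (index j))))
    c-scaling : ∀ g → ⟨ c , g ⟩ ≡ + 8 * ⟨ y , g ⟩
    c-scaling g = trans (sum-cong-≗ (λ ℓ → cong (_* g ℓ) (c≡8y ℓ))) (⟨*,⟩ (+ 8) y g)
    y-expansion : ∀ r → ⟨ y , transpose H r ⟩ ≡ + 2 * x r
    y-expansion r = *-cancelˡ-≡ (+ 8) _ _ (begin
      + 8 * ⟨ y , transpose H r ⟩ ≡⟨ sym (c-scaling (transpose H r)) ⟩
      ⟨ c , transpose H r ⟩       ≡⟨ transpose-*ᵥ-*ᵥ H columns-orthogonal x r ⟩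
      + 16 * x r                  ≡⟨ *-assoc (+ 8) (+ 2) (x r) ⟩
      + 8 * (+ 2 * x r)           ∎)
    ⟨c,c⟩≡64*size : ⟨ c , c ⟩ ≡ + 64 * + size
    ⟨c,c⟩≡64*size = begin
      ⟨ c , c ⟩                  ≡⟨ sum-cong-≗ (λ ℓ → cong (c ℓ *_) (c≡8y ℓ)) ⟩
      ⟨ c , (λ ℓ → + 8 * y ℓ) ⟩  ≡⟨ c-scaling (λ ℓ → + 8 * y ℓ) ⟩
      + 8 * ⟨ y , (λ ℓ → + 8 * y ℓ) ⟩ ≡⟨ cong (+ 8 *_) (⟨,*⟩ (+ 8) y y) ⟩
      + 8 * (+ 8 * ⟨ y , y ⟩)    ≡⟨ sym (*-assoc (+ 8) (+ 8) ⟨ y , y ⟩) ⟩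
      + 64 * ⟨ y , y ⟩           ≡⟨ cong (+ 64 *_) (trans (restrict y) (⟨sign,sign⟩ ±y)) ⟩
      + 64 * + size              ∎
    size≡4 : size ≡ 4
    size≡4 = +-injective (*-cancelˡ-≡ (+ 64) (+ size) (+ 4)
      (trans (sym ⟨c,c⟩≡64*size) (trans (parseval H columns-orthogonal x) (cong (+ 16 *_) (⟨sign,sign⟩ ±x)))))

corollary3p3 : (H : Matrix 16) → IsHadamard 16 H →
    ∃[ i ] ∃[ j ] ∃[ k ] ∃[ l ] (Distinct4 i j k l × T 16 H i j k l ≡ 0ℚ)
corollary3p3 H isH = [ chosen-rows-quadruple , support-quadruple ]′ (∃⊎∀ coefficient-values)
  where open Order16 H isH
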